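{- Let $\mathbf{k}$ be a nonempty index and let $F_\mathbf{k}(z)=\sum_{n=1}^\infty(-1)^{n-1}s^\star(\mathbf{k}^\vee,n)\binom{z}{n}$ be its Kawashima function. Then for every integer $N\geq 0$, \[F_\mathbf{k}(N)=S^\star(\mathbf{k},N).\] Conversely, if a Newton series $f(z)=\sum_{n=0}^\infty a_n\binom{z}{n}$ (with complex coefficients $a_n$) satisfies $f(N)=S^\star(\mathbf{k},N)$ for all integers $N\geq 0$, then $a_0=0$ and $a_n=(-1)^{n-1}s^\star(\mathbf{k}^\vee,n)$ for all $n\geq 1$, i.e. $f$ coincides with $F_\mathbf{k}$ coefficientwise.
   Context: An index is a finite sequence $\mathbf{k}=(k_1,\ldots,k_r)$ of positive integers; its weight is $\mathrm{wt}(\mathbf{k})=k_1+\cdots+k_r$, and we set $A(\mathbf{k})=\{k_1,k_1+k_2,\ldots,k_1+\cdots+k_{r-1}\}$. The Hoffman dual $\mathbf{k}^\vee$ of a nonempty index $\mathbf{k}$ is the unique index with $\mathrm{wt}(\mathbf{k}^\vee)=\mathrm{wt}(\mathbf{k})$ and $A(\mathbf{k})\amalg A(\mathbf{k}^\vee)=\{1,2,\ldots,\mathrm{wt}(\mathbf{k})-1\}$ (disjoint union). For a nonempty index $\mathbf{k}=(k_1,\ldots,k_r)$ and integer $N\ge 0$: $s^\star(\mathbf{k},N)=\sum_{0<m_1\leq\cdots\leq m_{r-1}\leq m_r=N}\frac{1}{m_1^{k_1}\cdots m_r^{k_r}}$ and $S^\star(\mathbf{k},N)=\sum_{0<m_1\leq\cdots\leq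 m_r\leq N}\frac{1}{m_1^{k_1}\cdots m_r^{k_r}}=\sum_{n=1}^N s^\star(\mathbf{k},n)$ (empty sums are $0$). At a nonnegative integer $N$ a Newton series $\sum_n a_n\binom{z}{n}$ reduces to the finite sum $\sum_{n=0}^N a_n\binom{N}{n}$. -}

module Defs where

open import Level using (Level)
open import Data.Nat as ℕ using (ℕ; zero; suc; _≤_; _<_)
open import Data.Nat.Properties using (m^n≢0)
open import Data.Nat.Combinatorics using (_C_)
open import Data.Integer using (+_)
open import Data.List using (List; []; _∷_; map; reverse)
open import Data.Nat.ListAction using (sum)
open import Data.List.Relation.Unary.All using (All)
open import Data.List.Membership.Propositional using (_∈_)
open import Data.Product using (_×_)
open import Data.Sum using (_⊎_)
open import Relation.Nullary using (¬_)
open import Relation.Binary.PropositionalEquality using (_≡_)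
open import Algebra.Bundles using (CommutativeRing)
open import Data.Rational as ℚ using (ℚ; 0ℚ; 1ℚ; -_)

IsIndex : List ℕ → Set
IsIndex k = All (1 ≤_) k

wt : List ℕ → ℕ
wt = sum

-- A(k1,...,kr) = {k1, k1+k2, ..., k1+...+k_{r-1}}  (as a list)
A : List ℕ → List ℕ
A []           = []
A (x ∷ [])     = []
A (x ∷ y ∷ ys) = x ∷ map (x ℕ.+_) (A (y ∷ ys))

-- l is the Hoffman dual of k:  wt l = wt k and
-- A(k) ⨿ A(l) = {1, ..., wt k - 1}  (disjoint union)
record IsHoffmanDual (k l : List ℕ) : Set where
  field
    index    : IsIndex l
    weight   : wt l ≡ wt k
    covers   : ∀ j → 1 ≤ j → j < wt k → j ∈ A k ⊎ j ∈ A l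
    inRange  : ∀ j → j ∈ A k ⊎ j ∈ A l → 1 ≤ j × j < wt k
    disjoint : ∀ j → ¬ (j ∈ A k × j ∈ A l)

Σ₁ : ℕ → (ℕ → ℚ) → ℚ
Σ₁ zero    f = 0ℚ
Σ₁ (suc n) f = Σ₁ n f ℚ.+ f (suc n)

Σ₀ : ℕ → (ℕ → ℚ) → ℚ
Σ₀ N f = f 0 ℚ.+ Σ₁ N f

invPow : ℕ → ℕ → ℚ
invPow m k = ℚ._/_ (+ 1) (suc m ℕ.^ k) {{m^n≢0 (suc m) k}}

-- For a *reversed* index (k_r, k_{r-1}, ..., k_1):
-- Srev (k_r,...,k_1) N = Σ_{0<m_1≤...≤m_r≤N} 1/(m_1^{k_1}...m_r^{k_r}),
-- with Srev [] N = 1.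
Srev : List ℕ → ℕ → ℚ
Srev []       N = 1ℚ
Srev (k ∷ ks) N = Σ₁ N (λ { zero → 0ℚ ; (suc m) → invPow m k ℚ.* Srev ks (suc m) })

S⋆ : List ℕ → ℕ → ℚ
S⋆ k N = Srev (reverse k) N

-- s⋆(k, N) = Σ_{0<m_1≤...≤m_{r-1}≤m_r=N} 1/(m_1^{k_1}...m_r^{k_r})
-- (empty sum 0 when N = 0)
s⋆ : List ℕ → ℕ → ℚ
s⋆ k N with reverse k
... | []       = 0ℚ
... | kr ∷ ks  with N
...   | zero   = 0ℚ
...   | suc m  = invPow m kr ℚ.* Srev ks (suc m)

signℚ : ℕ → ℚ
signℚ zero    = 1ℚ
signℚ (suc n) = - signℚ n

-- coefficients of the Kawashima function F_k, given the dual index kv: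
-- a_0 = 0, a_n = (-1)^{n-1} s⋆(kv, n) for n ≥ 1
kawashimaCoeff : List ℕ → ℕ → ℚ
kawashimaCoeff kv zero    = 0ℚ
kawashimaCoeff kv (suc m) = signℚ m ℚ.* s⋆ kv (suc m)

binomℚ : ℕ → ℕ → ℚ
binomℚ N n = ℚ._/_ (+ (N C n)) 1

-- value of the Newton series Σ a_n (z choose n) at z = N (finite sum)
newtonAt : (ℕ → ℚ) → ℕ → ℚ
newtonAt a N = Σ₀ N (λ n → binomℚ N n ℚ.* a n)

ΣR : ∀ {c ℓ} (R : CommutativeRing c ℓ) → ℕ → (ℕ → CommutativeRing.Carrier R) → CommutativeRing.Carrier R
ΣR R zero    f = f 0
ΣR R (suc n) f = ΣR R n f + f (suc n)
  where open CommutativeRing R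

{-# OPTIONS --safe #-}
-- Both sides of F_k(N) = S⋆(k,N) obey the same recursion along the structure of Hoffman duality:
-- (1)^∨ = (1), (k,1)^∨ = (l₁,…,l_s + 1) and (k₁,…,k_r + 1)^∨ = (l,1), where l = k^∨.
-- Appending 1 to k sends S⋆(k,·) to N ↦ Σ_{n≤N} S⋆(k,n)/n, and increasing k_r sends it to
-- N ↦ Σ_{n≤N} ∇S⋆(k,n)/n with ∇f(n) = f(n) − f(n−1). The corresponding moves on the dual send the
-- coefficients aₙ of a Newton series to aₙ/n and to (−1)^{n−1}/n · Σ_{m≤n} (−1)^{m−1} aₘ, and by
-- C(N−1,n−1)/n = C(N,n)/N and Pascal's rule these have exactly the same effect on the values at N.
-- As Hoffman duals are unique, this determines F_k. Conversely, the values at 0,…,N of a Newton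
-- series form a unitriangular linear system in a₀,…,a_N, so they determine the coefficients.
module Submission where

open import Defs
open import Level using (Level)
open import Function using (_∘_)
open import Data.Nat as ℕ using (ℕ; zero; suc; pred; NonZero; _≤_; _<_; z≤n; s≤s)
import Data.Nat.Properties as ℕP
open import Data.Nat.Combinatorics using (_C_; nCk+nC[k+1]≡[n+1]C[k+1]; nC1≡n; nCn≡1; k>n⇒nCk≡0)
open import Data.Nat.ListAction.Properties using (sum-++)
import Data.Integer as ℤ
import Data.Integer.Properties as ℤP
open import Data.Rational as ℚ using (ℚ; 0ℚ; 1ℚ; toℚᵘ; _/_; _+_; _*_; _-_; -_)
import Data.Rational.Properties as ℚP
open import Data.Rational.Properties using (+-*-commutativeRing)
import Data.Rational.Unnormalised as U
import Data.Rational.Unnormalised.Properties as UP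
open import Data.Rational.Solver using (module +-*-Solver)
open import Data.List using (List; []; _∷_; _∷ʳ_; map; reverse)
import Data.List.Properties as LP
open import Data.List.Relation.Unary.All using ([]; _∷_)
import Data.List.Relation.Unary.All.Properties as AllP
open import Data.List.Relation.Unary.Any using (here; there)
open import Data.List.Membership.Propositional using (_∈_)
open import Data.List.Membership.Propositional.Properties using (∈-map⁻; ∈-map⁺; ∈-++⁻; ∈-++⁺ˡ; ∈-++⁺ʳ)
open import Data.List.Relation.Binary.Subset.Propositional using (_⊆_)
open import Data.Product using (_×_; _,_; proj₁; proj₂; map₂; ∃₂)
open import Data.Sum using (_⊎_; inj₁; inj₂; swap)
open import Data.Empty using (⊥-elim)
open import Relation.Nullary using (¬_)
open import Relation.Binary.PropositionalEquality
open import Algebra.Bundles using (CommutativeRing)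
open import Algebra.Morphism.Structures using (module RingMorphisms)
import Algebra.Properties.Group as GroupProperties

open +-*-Solver using (solve; _:=_; _:+_; _:*_; :-_; _:-_; con)

toℚ : ℕ → ℚ
toℚ n = ℤ.+ n / 1

toℚᵘ-/ : ∀ i n .{{_ : NonZero n}} → toℚᵘ (i / n) U.≃ U.mkℚᵘ i (pred n)
toℚᵘ-/ i (suc d) = ℚP.toℚᵘ-fromℚᵘ (U.mkℚᵘ i d)

toℚ-+ : ∀ a b → toℚ (a ℕ.+ b) ≡ toℚ a + toℚ b
toℚ-+ a b = ℚP.toℚᵘ-injective (begin
  toℚᵘ (toℚ (a ℕ.+ b))                   ≈⟨ toℚᵘ-/ (ℤ.+ (a ℕ.+ b)) 1 ⟩
  U.mkℚᵘ (ℤ.+ (a ℕ.+ b)) 0               ≈⟨ U.*≡* (cong (ℤ._* ℤ.+ 1) (sym (cong₂ ℤ._+_ (ℤP.*-identityʳ (ℤ.+ a)) (ℤP.*-identityʳ (ℤ.+ b))))) ⟩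
  U.mkℚᵘ (ℤ.+ a) 0 U.+ U.mkℚᵘ (ℤ.+ b) 0  ≈⟨ UP.+-cong (toℚᵘ-/ (ℤ.+ a) 1) (toℚᵘ-/ (ℤ.+ b) 1) ⟨
  toℚᵘ (toℚ a) U.+ toℚᵘ (toℚ b)          ≈⟨ ℚP.toℚᵘ-homo-+ (toℚ a) (toℚ b) ⟨
  toℚᵘ (toℚ a + toℚ b)                   ∎)
  where open UP.≃-Reasoning

toℚ-* : ∀ a b → toℚ (a ℕ.* b) ≡ toℚ a * toℚ b
toℚ-* a b = ℚP.toℚᵘ-injective (begin
  toℚᵘ (toℚ (a ℕ.* b))                   ≈⟨ toℚᵘ-/ (ℤ.+ (a ℕ.* b)) 1 ⟩
  U.mkℚᵘ (ℤ.+ (a ℕ.* b)) 0               ≈⟨ U.*≡* (cong (ℤ._* ℤ.+ 1) (ℤP.pos-* a b)) ⟩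
  U.mkℚᵘ (ℤ.+ a) 0 U.* U.mkℚᵘ (ℤ.+ b) 0  ≈⟨ UP.*-cong (toℚᵘ-/ (ℤ.+ a) 1) (toℚᵘ-/ (ℤ.+ b) 1) ⟨
  toℚᵘ (toℚ a) U.* toℚᵘ (toℚ b)          ≈⟨ ℚP.toℚᵘ-homo-* (toℚ a) (toℚ b) ⟨
  toℚᵘ (toℚ a * toℚ b)                   ∎)
  where open UP.≃-Reasoning

1/n*n≡1 : ∀ n .{{_ : NonZero n}} → (ℤ.+ 1 / n) * toℚ n ≡ 1ℚ
1/n*n≡1 n@(suc d) = ℚP.toℚᵘ-injective (begin
  toℚᵘ ((ℤ.+ 1 / n) * toℚ n)             ≈⟨ ℚP.toℚᵘ-homo-* (ℤ.+ 1 / n) (toℚ n) ⟩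
  toℚᵘ (ℤ.+ 1 / n) U.* toℚᵘ (toℚ n)      ≈⟨ UP.*-cong (toℚᵘ-/ (ℤ.+ 1) n) (toℚᵘ-/ (ℤ.+ n) 1) ⟩
  U.mkℚᵘ (ℤ.+ 1) d U.* U.mkℚᵘ (ℤ.+ n) 0  ≈⟨ U.*≡* (trans (ℤP.*-identityʳ _) (trans (ℤP.*-identityˡ (ℤ.+ n))
                                              (sym (trans (ℤP.*-identityˡ _) (cong (λ m → ℤ.+ suc m) (ℕP.*-identityʳ d)))))) ⟩
  toℚᵘ 1ℚ                                ∎)
  where open UP.≃-Reasoning

open ≡-Reasoning

*-inverse-unique : ∀ {x y z} → y * x ≡ 1ℚ → z * x ≡ 1ℚ → y ≡ z
*-inverse-unique {x} {y} {z} yx≡1 zx≡1 = begin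
  y            ≡⟨ ℚP.*-identityʳ y ⟨
  y * 1ℚ       ≡⟨ cong (y *_) zx≡1 ⟨
  y * (z * x)  ≡⟨ solve 3 (λ x y z → y :* (z :* x) := z :* (y :* x)) refl x y z ⟩
  z * (y * x)  ≡⟨ cong (z *_) yx≡1 ⟩
  z * 1ℚ       ≡⟨ ℚP.*-identityʳ z ⟩
  z            ∎

cross-multiply : ∀ {a b p q p⁻¹ q⁻¹} → p⁻¹ * p ≡ 1ℚ → q⁻¹ * q ≡ 1ℚ → a * q ≡ p * b → a * p⁻¹ ≡ q⁻¹ * b
cross-multiply {a} {b} {p} {q} {p⁻¹} {q⁻¹} p⁻¹p≡1 q⁻¹q≡1 aq≡pb = begin
  a * p⁻¹                  ≡⟨ ℚP.*-identityʳ (a * p⁻¹) ⟨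
  a * p⁻¹ * 1ℚ             ≡⟨ cong (a * p⁻¹ *_) q⁻¹q≡1 ⟨
  a * p⁻¹ * (q⁻¹ * q)      ≡⟨ solve 4 (λ a p⁻¹ q⁻¹ q → a :* p⁻¹ :* (q⁻¹ :* q) := q⁻¹ :* p⁻¹ :* (a :* q)) refl a p⁻¹ q⁻¹ q ⟩
  q⁻¹ * p⁻¹ * (a * q)      ≡⟨ cong (q⁻¹ * p⁻¹ *_) aq≡pb ⟩
  q⁻¹ * p⁻¹ * (p * b)      ≡⟨ solve 4 (λ q⁻¹ p⁻¹ p b → q⁻¹ :* p⁻¹ :* (p :* b) := q⁻¹ :* (p⁻¹ :* p) :* b) refl q⁻¹ p⁻¹ p b ⟩
  q⁻¹ * (p⁻¹ * p) * b      ≡⟨ cong (λ x → q⁻¹ * x * b) p⁻¹p≡1 ⟩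
  q⁻¹ * 1ℚ * b             ≡⟨ cong (_* b) (ℚP.*-identityʳ q⁻¹) ⟩
  q⁻¹ * b                  ∎

invPow-inverse : ∀ m k → invPow m k * toℚ (suc m ℕ.^ k) ≡ 1ℚ
invPow-inverse m k = 1/n*n≡1 (suc m ℕ.^ k) {{ℕP.m^n≢0 (suc m) k}}

invPow-1-inverse : ∀ m → invPow m 1 * toℚ (suc m) ≡ 1ℚ
invPow-1-inverse m = subst (λ n → invPow m 1 * toℚ n ≡ 1ℚ) (ℕP.*-identityʳ (suc m)) (invPow-inverse m 1)

invPow-suc : ∀ m k → invPow m (suc k) ≡ invPow m 1 * invPow m k
invPow-suc m k = *-inverse-unique (invPow-inverse m (suc k)) (begin
  invPow m 1 * invPow m k * toℚ (suc m ℕ.^ suc k)            ≡⟨ cong (invPow m 1 * invPow m k *_) (toℚ-* (suc m) (suc m ℕ.^ k)) ⟩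
  invPow m 1 * invPow m k * (toℚ (suc m) * toℚ (suc m ℕ.^ k))
    ≡⟨ solve 4 (λ a b c d → a :* b :* (c :* d) := (a :* c) :* (b :* d)) refl (invPow m 1) (invPow m k) (toℚ (suc m)) (toℚ (suc m ℕ.^ k)) ⟩
  (invPow m 1 * toℚ (suc m)) * (invPow m k * toℚ (suc m ℕ.^ k)) ≡⟨ cong₂ _*_ (invPow-1-inverse m) (invPow-inverse m k) ⟩
  1ℚ                                                           ∎)

signℚ²≡1 : ∀ m → signℚ m * signℚ m ≡ 1ℚ
signℚ²≡1 zero    = refl
signℚ²≡1 (suc m) = trans (solve 1 (λ s → (:- s) :* (:- s) := s :* s) refl (signℚ m)) (signℚ²≡1 m)

binomial-absorption : ∀ n k → suc k ℕ.* (suc n C suc k) ≡ suc n ℕ.* (n C k)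
binomial-absorption zero    zero    = refl
binomial-absorption zero    (suc k) = ℕP.*-zeroʳ (suc (suc k))
binomial-absorption (suc n) zero    = trans (ℕP.+-identityʳ _) (trans (nC1≡n (suc (suc n))) (sym (ℕP.*-identityʳ (suc (suc n)))))
binomial-absorption (suc n) (suc k) = begin
  suc (suc k) ℕ.* (suc (suc n) C suc (suc k))             ≡⟨ cong (suc (suc k) ℕ.*_) (nCk+nC[k+1]≡[n+1]C[k+1] (suc n) (suc k)) ⟨
  suc (suc k) ℕ.* (x ℕ.+ y)                               ≡⟨ ℕP.*-distribˡ-+ (suc (suc k)) x y ⟩
  (x ℕ.+ suc k ℕ.* x) ℕ.+ suc (suc k) ℕ.* y               ≡⟨ cong₂ (λ u v → (x ℕ.+ u) ℕ.+ v) (binomial-absorption n k) (binomial-absorption n (suc k)) ⟩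
  (x ℕ.+ suc n ℕ.* (n C k)) ℕ.+ suc n ℕ.* (n C suc k)     ≡⟨ ℕP.+-assoc x _ _ ⟩
  x ℕ.+ (suc n ℕ.* (n C k) ℕ.+ suc n ℕ.* (n C suc k))     ≡⟨ cong (x ℕ.+_) (ℕP.*-distribˡ-+ (suc n) (n C k) (n C suc k)) ⟨
  x ℕ.+ suc n ℕ.* (n C k ℕ.+ n C suc k)                   ≡⟨ cong (λ u → x ℕ.+ suc n ℕ.* u) (nCk+nC[k+1]≡[n+1]C[k+1] n k) ⟩
  suc (suc n) ℕ.* x                                       ∎
  where
  x = suc n C suc k
  y = suc n C suc (suc k)

binomℚ-absorption : ∀ M j → binomℚ M j * invPow j 1 ≡ invPow M 1 * binomℚ (suc M) (suc j)
binomℚ-absorption M j = cross-multiply {binomℚ M j} {binomℚ (suc M) (suc j)} {p⁻¹ = invPow j 1} {q⁻¹ = invPow M 1}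
  (invPow-1-inverse j) (invPow-1-inverse M) (begin
  toℚ (M C j) * toℚ (suc M)            ≡⟨ toℚ-* (M C j) (suc M) ⟨
  toℚ ((M C j) ℕ.* suc M)              ≡⟨ cong toℚ (ℕP.*-comm (M C j) (suc M)) ⟩
  toℚ (suc M ℕ.* (M C j))              ≡⟨ cong toℚ (binomial-absorption M j) ⟨
  toℚ (suc j ℕ.* (suc M C suc j))      ≡⟨ toℚ-* (suc j) (suc M C suc j) ⟩
  toℚ (suc j) * toℚ (suc M C suc j)    ∎)

binomℚ-pascal : ∀ n k → binomℚ (suc n) (suc k) ≡ binomℚ n k + binomℚ n (suc k)
binomℚ-pascal n k = trans (cong toℚ (sym (nCk+nC[k+1]≡[n+1]C[k+1] n k))) (toℚ-+ (n C k) (n C suc k))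

Σ₁-cong : ∀ N {f g : ℕ → ℚ} → (∀ m → f (suc m) ≡ g (suc m)) → Σ₁ N f ≡ Σ₁ N g
Σ₁-cong zero    f≗g = refl
Σ₁-cong (suc N) f≗g = cong₂ _+_ (Σ₁-cong N f≗g) (f≗g N)

Σ₁-distrib-+ : ∀ N (f g : ℕ → ℚ) → Σ₁ N (λ n → f n + g n) ≡ Σ₁ N f + Σ₁ N g
Σ₁-distrib-+ zero    f g = refl
Σ₁-distrib-+ (suc N) f g = trans (cong (_+ (f (suc N) + g (suc N))) (Σ₁-distrib-+ N f g))
  (solve 4 (λ a b c d → (a :+ b) :+ (c :+ d) := (a :+ c) :+ (b :+ d)) refl (Σ₁ N f) (Σ₁ N g) (f (suc N)) (g (suc N)))

*-distribˡ-Σ₁ : ∀ N c (f : ℕ → ℚ) → c * Σ₁ N f ≡ Σ₁ N (λ n → c * f n)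
*-distribˡ-Σ₁ zero    c f = ℚP.*-zeroʳ c
*-distribˡ-Σ₁ (suc N) c f = trans (ℚP.*-distribˡ-+ c (Σ₁ N f) (f (suc N))) (cong (_+ c * f (suc N)) (*-distribˡ-Σ₁ N c f))

Σ₁-suc : ∀ N (f : ℕ → ℚ) → Σ₁ (suc N) f ≡ f 1 + Σ₁ N (f ∘ suc)
Σ₁-suc zero    f = ℚP.+-comm 0ℚ (f 1)
Σ₁-suc (suc N) f = trans (cong (_+ f (suc (suc N))) (Σ₁-suc N f)) (ℚP.+-assoc (f 1) (Σ₁ N (f ∘ suc)) (f (suc (suc N))))

Σ₁-head : ∀ N (f : ℕ → ℚ) → (∀ m → f (suc (suc m)) ≡ 0ℚ) → Σ₁ (suc N) f ≡ f 1
Σ₁-head N f tail≡0 = begin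
  Σ₁ (suc N) f                 ≡⟨ Σ₁-suc N f ⟩
  f 1 + Σ₁ N (f ∘ suc)         ≡⟨ cong (f 1 +_) (Σ₁-cong N tail≡0) ⟩
  f 1 + Σ₁ N (λ _ → 0ℚ)        ≡⟨ cong (f 1 +_) (*-distribˡ-Σ₁ N 0ℚ (λ _ → 0ℚ)) ⟨
  f 1 + 0ℚ * Σ₁ N (λ _ → 0ℚ)   ≡⟨ solve 2 (λ a s → a :+ con 0ℚ :* s := a) refl (f 1) (Σ₁ N (λ _ → 0ℚ)) ⟩
  f 1                          ∎

-- Newton series

newton : (ℕ → ℚ) → ℕ → ℚ
newton c N = Σ₁ N (λ n → binomℚ N n * c n)

shiftedNewton : (ℕ → ℚ) → ℕ → ℚ
shiftedNewton c M = Σ₁ (suc M) (λ n → binomℚ M (pred n) * c n)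

∇ : (ℕ → ℚ) → ℕ → ℚ
∇ f n = f n - f (pred n)

alternate : (ℕ → ℚ) → ℕ → ℚ
alternate c zero    = 0ℚ
alternate c (suc m) = signℚ m * c (suc m)

divided : (ℕ → ℚ) → ℕ → ℚ
divided c zero    = 0ℚ
divided c (suc m) = invPow m 1 * c (suc m)

partialSums : (ℕ → ℚ) → ℕ → ℚ
partialSums c N = Σ₁ N c

newton-cong : ∀ {c d} N → (∀ m → c (suc m) ≡ d (suc m)) → newton c N ≡ newton d N
newton-cong N c≗d = Σ₁-cong N (λ m → cong (binomℚ N (suc m) *_) (c≗d m))

newtonAt≡newton : ∀ c → c 0 ≡ 0ℚ → ∀ N → newtonAt c N ≡ newton c N
newtonAt≡newton c c0≡0 N = begin
  binomℚ N 0 * c 0 + newton c N   ≡⟨ cong (λ x → binomℚ N 0 * x + newton c N) c0≡0 ⟩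
  binomℚ N 0 * 0ℚ + newton c N    ≡⟨ cong (_+ newton c N) (ℚP.*-zeroʳ (binomℚ N 0)) ⟩
  0ℚ + newton c N                 ≡⟨ ℚP.+-identityˡ (newton c N) ⟩
  newton c N                      ∎

newton-suc : ∀ c M → newton c (suc M) ≡ newton c M + shiftedNewton c M
newton-suc c M = begin
  newton c (suc M)
    ≡⟨ Σ₁-cong (suc M) (λ j → trans (cong (_* c (suc j)) (binomℚ-pascal M j))
                                     (ℚP.*-distribʳ-+ (c (suc j)) (binomℚ M j) (binomℚ M (suc j)))) ⟩
  Σ₁ (suc M) (λ n → binomℚ M (pred n) * c n + binomℚ M n * c n)
    ≡⟨ Σ₁-distrib-+ (suc M) (λ n → binomℚ M (pred n) * c n) (λ n → binomℚ M n * c n) ⟩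
  shiftedNewton c M + (newton c M + binomℚ M (suc M) * c (suc M))
    ≡⟨ cong (λ x → shiftedNewton c M + (newton c M + toℚ x * c (suc M))) (k>n⇒nCk≡0 (ℕP.n<1+n M)) ⟩
  shiftedNewton c M + (newton c M + 0ℚ * c (suc M))
    ≡⟨ solve 3 (λ s t x → s :+ (t :+ con 0ℚ :* x) := t :+ s) refl (shiftedNewton c M) (newton c M) (c (suc M)) ⟩
  newton c M + shiftedNewton c M ∎

∇-newton : ∀ c M → ∇ (newton c) (suc M) ≡ shiftedNewton c M
∇-newton c M = begin
  newton c (suc M) - newton c M                          ≡⟨ cong (_- newton c M) (newton-suc c M) ⟩
  (newton c M + shiftedNewton c M) - newton c M          ≡⟨ solve 2 (λ t s → (t :+ s) :- t := s) refl (newton c M) (shiftedNewton c M) ⟩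
  shiftedNewton c M                                      ∎

shiftedNewton-divided : ∀ c M → shiftedNewton (divided c) M ≡ invPow M 1 * newton c (suc M)
shiftedNewton-divided c M = begin
  shiftedNewton (divided c) M
    ≡⟨ Σ₁-cong (suc M) (λ j → begin
         binomℚ M j * (invPow j 1 * c (suc j))                ≡⟨ ℚP.*-assoc (binomℚ M j) (invPow j 1) (c (suc j)) ⟨
         binomℚ M j * invPow j 1 * c (suc j)                  ≡⟨ cong (_* c (suc j)) (binomℚ-absorption M j) ⟩
         invPow M 1 * binomℚ (suc M) (suc j) * c (suc j)      ≡⟨ ℚP.*-assoc (invPow M 1) _ (c (suc j)) ⟩
         invPow M 1 * (binomℚ (suc M) (suc j) * c (suc j))    ∎) ⟩
  Σ₁ (suc M) (λ n → invPow M 1 * (binomℚ (suc M) n * c n))   ≡⟨ *-distribˡ-Σ₁ (suc M) (invPow M 1) (λ n → binomℚ (suc M) n * c n) ⟨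
  invPow M 1 * newton c (suc M)                              ∎

newton-divided : ∀ c N → newton (divided c) N ≡ Σ₁ N (divided (newton c))
newton-divided c zero    = refl
newton-divided c (suc M) = begin
  newton (divided c) (suc M)                                 ≡⟨ newton-suc (divided c) M ⟩
  newton (divided c) M + shiftedNewton (divided c) M         ≡⟨ cong₂ _+_ (newton-divided c M) (shiftedNewton-divided c M) ⟩
  Σ₁ M (divided (newton c)) + invPow M 1 * newton c (suc M)  ∎

alternate-partialSums-step : ∀ c j → let d = alternate (partialSums (alternate c)) in d (suc j) + d j ≡ c (suc j)
alternate-partialSums-step c zero    = solve 1 (λ x → con 1ℚ :* (con 0ℚ :+ con 1ℚ :* x) :+ con 0ℚ := x) refl (c 1)
alternate-partialSums-step c (suc i) = begin
  - s * (P + - s * x) + s * P     ≡⟨ solve 3 (λ s P x → (:- s) :* (P :+ (:- s) :* x) :+ s :* P := (s :* s) :* x) refl s P x ⟩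
  (s * s) * x                     ≡⟨ cong (_* x) (signℚ²≡1 i) ⟩
  1ℚ * x                          ≡⟨ ℚP.*-identityˡ x ⟩
  x                               ∎
  where
  s = signℚ i
  P = partialSums (alternate c) (suc i)
  x = c (suc (suc i))

newton-alternate-partialSums : ∀ c N → newton (alternate (partialSums (alternate c))) N ≡ ∇ (newton c) N
newton-alternate-partialSums c zero    = refl
newton-alternate-partialSums c (suc M) = begin
  newton d (suc M)                      ≡⟨ newton-suc d M ⟩
  newton d M + shiftedNewton d M        ≡⟨ ℚP.+-comm (newton d M) (shiftedNewton d M) ⟩
  shiftedNewton d M + newton d M        ≡⟨ cong (shiftedNewton d M +_) shifted-d≡newton-d ⟨
  shiftedNewton d M + Σ₁ (suc M) (λ n → binomℚ M (pred n) * d (pred n))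
    ≡⟨ Σ₁-distrib-+ (suc M) (λ n → binomℚ M (pred n) * d n) (λ n → binomℚ M (pred n) * d (pred n)) ⟨
  Σ₁ (suc M) (λ n → binomℚ M (pred n) * d n + binomℚ M (pred n) * d (pred n))
    ≡⟨ Σ₁-cong (suc M) (λ j → trans (sym (ℚP.*-distribˡ-+ (binomℚ M j) (d (suc j)) (d j)))
                                     (cong (binomℚ M j *_) (alternate-partialSums-step c j))) ⟩
  shiftedNewton c M                     ≡⟨ ∇-newton c M ⟨
  ∇ (newton c) (suc M)                  ∎
  where
  d = alternate (partialSums (alternate c))
  shifted-d≡newton-d : Σ₁ (suc M) (λ n → binomℚ M (pred n) * d (pred n)) ≡ newton d M
  shifted-d≡newton-d = begin
    Σ₁ (suc M) (λ n → binomℚ M (pred n) * d (pred n))   ≡⟨ Σ₁-suc M (λ n → binomℚ M (pred n) * d (pred n)) ⟩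
    binomℚ M 0 * 0ℚ + newton d M                        ≡⟨ cong (_+ newton d M) (ℚP.*-zeroʳ (binomℚ M 0)) ⟩
    0ℚ + newton d M                                     ≡⟨ ℚP.+-identityˡ (newton d M) ⟩
    newton d M                                          ∎

newton-divided-∇ : ∀ c N → newton (divided (alternate (partialSums (alternate c)))) N ≡ Σ₁ N (divided (∇ (newton c)))
newton-divided-∇ c N = trans (newton-divided (alternate (partialSums (alternate c))) N)
  (Σ₁-cong N (λ m → cong (invPow m 1 *_) (newton-alternate-partialSums c (suc m))))

-- Star sums along Hoffman duality

-- newton δ₁ N = N = S⋆((0),N), so the base case (1)^∨ = (1) is the increment step started from (0).
δ₁ : ℕ → ℚ
δ₁ 1 = 1ℚ
δ₁ _ = 0ℚ

∇-newton-δ₁ : ∀ m → ∇ (newton δ₁) (suc m) ≡ 1ℚ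
∇-newton-δ₁ m = trans (∇-newton δ₁ m) (Σ₁-head m _ (λ i → ℚP.*-zeroʳ (binomℚ m (suc i))))

partialSums-alternate-δ₁ : ∀ m → partialSums (alternate δ₁) (suc m) ≡ 1ℚ
partialSums-alternate-δ₁ m = Σ₁-head m (alternate δ₁) (λ i → ℚP.*-zeroʳ (signℚ (suc i)))

alternate-involutive : ∀ c m → alternate (alternate c) (suc m) ≡ c (suc m)
alternate-involutive c m = begin
  signℚ m * (signℚ m * c (suc m))   ≡⟨ ℚP.*-assoc (signℚ m) (signℚ m) (c (suc m)) ⟨
  signℚ m * signℚ m * c (suc m)     ≡⟨ cong (_* c (suc m)) (signℚ²≡1 m) ⟩
  1ℚ * c (suc m)                    ≡⟨ ℚP.*-identityˡ (c (suc m)) ⟩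
  c (suc m)                         ∎

s⋆-suc : ∀ k {b s} m → reverse k ≡ b ∷ s → s⋆ k (suc m) ≡ invPow m b * Srev s (suc m)
s⋆-suc k m rev-k≡ rewrite rev-k≡ = refl

s⋆-reverse : ∀ b s m → s⋆ (reverse (b ∷ s)) (suc m) ≡ invPow m b * Srev s (suc m)
s⋆-reverse b s m = s⋆-suc (reverse (b ∷ s)) m (LP.reverse-involutive (b ∷ s))

Srev-partialSums : ∀ b s N → Srev (b ∷ s) N ≡ partialSums (s⋆ (reverse (b ∷ s))) N
Srev-partialSums b s N = Σ₁-cong N (λ m → sym (s⋆-reverse b s m))

Srev-increment : ∀ a r N → Srev (suc a ∷ r) N ≡ Σ₁ N (divided (∇ (Srev (a ∷ r))))
Srev-increment a r N = Σ₁-cong N (λ m → begin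
  invPow m (suc a) * Srev r (suc m)                           ≡⟨ cong (_* Srev r (suc m)) (invPow-suc m a) ⟩
  invPow m 1 * invPow m a * Srev r (suc m)
    ≡⟨ solve 4 (λ i j x t → i :* j :* x := i :* ((t :+ j :* x) :- t)) refl (invPow m 1) (invPow m a) (Srev r (suc m)) (Srev (a ∷ r) m) ⟩
  invPow m 1 * ∇ (Srev (a ∷ r)) (suc m)                      ∎)

kawashimaCoeff-base : ∀ m → kawashimaCoeff (1 ∷ []) (suc m) ≡ divided (alternate (partialSums (alternate δ₁))) (suc m)
kawashimaCoeff-base m = begin
  signℚ m * (invPow m 1 * 1ℚ)                                  ≡⟨ solve 2 (λ s i → s :* (i :* con 1ℚ) := i :* (s :* con 1ℚ)) refl (signℚ m) (invPow m 1) ⟩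
  invPow m 1 * (signℚ m * 1ℚ)                                  ≡⟨ cong (λ x → invPow m 1 * (signℚ m * x)) (partialSums-alternate-δ₁ m) ⟨
  invPow m 1 * (signℚ m * partialSums (alternate δ₁) (suc m))  ∎

kawashimaCoeff-extend : ∀ b s m →
  kawashimaCoeff (reverse (suc b ∷ s)) (suc m) ≡ divided (kawashimaCoeff (reverse (b ∷ s))) (suc m)
kawashimaCoeff-extend b s m = begin
  signℚ m * s⋆ (reverse (suc b ∷ s)) (suc m)              ≡⟨ cong (signℚ m *_) (s⋆-reverse (suc b) s m) ⟩
  signℚ m * (invPow m (suc b) * Srev s (suc m))           ≡⟨ cong (λ x → signℚ m * (x * Srev s (suc m))) (invPow-suc m b) ⟩
  signℚ m * (invPow m 1 * invPow m b * Srev s (suc m))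
    ≡⟨ solve 4 (λ g i j x → g :* (i :* j :* x) := i :* (g :* (j :* x))) refl (signℚ m) (invPow m 1) (invPow m b) (Srev s (suc m)) ⟩
  invPow m 1 * (signℚ m * (invPow m b * Srev s (suc m)))  ≡⟨ cong (λ x → invPow m 1 * (signℚ m * x)) (s⋆-reverse b s m) ⟨
  invPow m 1 * (signℚ m * s⋆ (reverse (b ∷ s)) (suc m))   ∎

kawashimaCoeff-increment : ∀ b s m → let c = kawashimaCoeff (reverse (b ∷ s)) in
  kawashimaCoeff (reverse (1 ∷ b ∷ s)) (suc m) ≡ divided (alternate (partialSums (alternate c))) (suc m)
kawashimaCoeff-increment b s m = begin
  signℚ m * s⋆ (reverse (1 ∷ b ∷ s)) (suc m)         ≡⟨ cong (signℚ m *_) (s⋆-reverse 1 (b ∷ s) m) ⟩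
  signℚ m * (invPow m 1 * Srev (b ∷ s) (suc m))      ≡⟨ cong (λ x → signℚ m * (invPow m 1 * x)) Srev≡ ⟩
  signℚ m * (invPow m 1 * P)                         ≡⟨ solve 3 (λ g i x → g :* (i :* x) := i :* (g :* x)) refl (signℚ m) (invPow m 1) P ⟩
  invPow m 1 * (signℚ m * P)                         ∎
  where
  c = kawashimaCoeff (reverse (b ∷ s))
  P = partialSums (alternate c) (suc m)
  Srev≡ : Srev (b ∷ s) (suc m) ≡ P
  Srev≡ = trans (Srev-partialSums b s (suc m)) (Σ₁-cong (suc m) (λ i → sym (alternate-involutive (s⋆ (reverse (b ∷ s))) i)))

-- Dualʳ (reverse k) (reverse l) means l = k^∨; indices are stored reversed, as in Srev, so that
-- the last entries, which the recursion changes, sit at the head.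
data Dualʳ : List ℕ → List ℕ → Set where
  base      : Dualʳ (1 ∷ []) (1 ∷ [])
  extend    : ∀ {a r b s} → Dualʳ (a ∷ r) (b ∷ s) → Dualʳ (1 ∷ a ∷ r) (suc b ∷ s)
  increment : ∀ {a r b s} → Dualʳ (a ∷ r) (b ∷ s) → Dualʳ (suc a ∷ r) (1 ∷ b ∷ s)

newton-kawashimaCoeff : ∀ {rk s} → Dualʳ rk s → ∀ N → newton (kawashimaCoeff (reverse s)) N ≡ Srev rk N
newton-kawashimaCoeff base N = begin
  newton (kawashimaCoeff (1 ∷ [])) N                          ≡⟨ newton-cong N kawashimaCoeff-base ⟩
  newton (divided (alternate (partialSums (alternate δ₁)))) N  ≡⟨ newton-divided-∇ δ₁ N ⟩
  Σ₁ N (divided (∇ (newton δ₁)))                              ≡⟨ Σ₁-cong N (λ m → cong (invPow m 1 *_) (∇-newton-δ₁ m)) ⟩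
  Srev (1 ∷ []) N                                             ∎
newton-kawashimaCoeff (extend {a} {r} {b} {s} d) N = begin
  newton (kawashimaCoeff (reverse (suc b ∷ s))) N  ≡⟨ newton-cong N (kawashimaCoeff-extend b s) ⟩
  newton (divided c) N                             ≡⟨ newton-divided c N ⟩
  Σ₁ N (divided (newton c))                        ≡⟨ Σ₁-cong N (λ m → cong (invPow m 1 *_) (newton-kawashimaCoeff d (suc m))) ⟩
  Srev (1 ∷ a ∷ r) N                               ∎
  where c = kawashimaCoeff (reverse (b ∷ s))
newton-kawashimaCoeff (increment {a} {r} {b} {s} d) N = begin
  newton (kawashimaCoeff (reverse (1 ∷ b ∷ s))) N            ≡⟨ newton-cong N (kawashimaCoeff-increment b s) ⟩
  newton (divided (alternate (partialSums (alternate c)))) N  ≡⟨ newton-divided-∇ c N ⟩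
  Σ₁ N (divided (∇ (newton c)))
    ≡⟨ Σ₁-cong N (λ m → cong (invPow m 1 *_) (cong₂ _-_ (newton-kawashimaCoeff d (suc m)) (newton-kawashimaCoeff d m))) ⟩
  Σ₁ N (divided (∇ (Srev (a ∷ r))))                          ≡⟨ Srev-increment a r N ⟨
  Srev (suc a ∷ r) N                                         ∎
  where c = kawashimaCoeff (reverse (b ∷ s))

-- Combinatorics of Hoffman duality

open IsHoffmanDual

wt-∷ʳ : ∀ xs a → wt (xs ∷ʳ a) ≡ wt xs ℕ.+ a
wt-∷ʳ xs a = trans (sum-++ xs (a ∷ [])) (cong (wt xs ℕ.+_) (ℕP.+-identityʳ a))

wt-positive : ∀ {xs} → IsIndex xs → xs ≢ [] → 1 ≤ wt xs
wt-positive {[]}     _        xs≢[] = ⊥-elim (xs≢[] refl)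
wt-positive {x ∷ xs} (1≤x ∷ _) _    = ℕP.≤-trans 1≤x (ℕP.m≤m+n x (wt xs))

∷ʳ≢[] : ∀ {X : Set} (xs : List X) a → xs ∷ʳ a ≢ []
∷ʳ≢[] []      a ()
∷ʳ≢[] (x ∷ xs) a ()

A-∷ʳ-last : ∀ xs a b → A (xs ∷ʳ a) ≡ A (xs ∷ʳ b)
A-∷ʳ-last []           a b = refl
A-∷ʳ-last (x ∷ [])     a b = refl
A-∷ʳ-last (x ∷ y ∷ ys) a b = cong (λ u → x ∷ map (x ℕ.+_) u) (A-∷ʳ-last (y ∷ ys) a b)

A-∷ʳ : ∀ xs a → xs ≢ [] → A (xs ∷ʳ a) ≡ A xs ∷ʳ wt xs
A-∷ʳ []           a xs≢[] = ⊥-elim (xs≢[] refl)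
A-∷ʳ (x ∷ [])     a _     = cong (_∷ []) (sym (ℕP.+-identityʳ x))
A-∷ʳ (x ∷ y ∷ ys) a _     = cong (x ∷_) (trans (cong (map (x ℕ.+_)) (A-∷ʳ (y ∷ ys) a λ ())) (LP.map-++ (x ℕ.+_) (A (y ∷ ys)) _))

HoffmanDual-sym : ∀ {k l} → IsIndex k → IsHoffmanDual k l → IsHoffmanDual l k
HoffmanDual-sym ik d = record
  { index    = ik
  ; weight   = sym (weight d)
  ; covers   = λ j 1≤j j<wt → swap (covers d j 1≤j (subst (j <_) (weight d) j<wt))
  ; inRange  = λ j j∈A → let 1≤j , j<wt = inRange d j (swap j∈A) in 1≤j , subst (j <_) (sym (weight d)) j<wt
  ; disjoint = λ j (j∈Al , j∈Ak) → disjoint d j (j∈Ak , j∈Al)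
  }

HoffmanDual-∷ʳ-1 : ∀ {K L b} → K ≢ [] → IsHoffmanDual K (L ∷ʳ b) → IsHoffmanDual (K ∷ʳ 1) (L ∷ʳ suc b)
HoffmanDual-∷ʳ-1 {K} {L} {b} K≢[] d = record
  { index    = AllP.∷ʳ⁺ (proj₁ (AllP.∷ʳ⁻ (index d))) (s≤s z≤n)
  ; weight   = begin
      wt (L ∷ʳ suc b)       ≡⟨ trans (wt-∷ʳ L (suc b)) (ℕP.+-suc (wt L) b) ⟩
      suc (wt L ℕ.+ b)      ≡⟨ cong suc (trans (sym (wt-∷ʳ L b)) (weight d)) ⟩
      suc (wt K)            ≡⟨ wt-K∷ʳ1 ⟨
      wt (K ∷ʳ 1)           ∎
  ; covers   = covers′
  ; inRange  = inRange′
  ; disjoint = disjoint′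
  }
  where
  w = wt K
  wt-K∷ʳ1 : wt (K ∷ʳ 1) ≡ suc w
  wt-K∷ʳ1 = trans (wt-∷ʳ K 1) (ℕP.+-comm w 1)
  AK : A (K ∷ʳ 1) ≡ A K ∷ʳ w
  AK = A-∷ʳ K 1 K≢[]
  AL : A (L ∷ʳ suc b) ≡ A (L ∷ʳ b)
  AL = A-∷ʳ-last L (suc b) b
  covers′ : ∀ j → 1 ≤ j → j < wt (K ∷ʳ 1) → j ∈ A (K ∷ʳ 1) ⊎ j ∈ A (L ∷ʳ suc b)
  covers′ j 1≤j j<wt with ℕP.m≤n⇒m<n∨m≡n (ℕP.≤-pred (subst (j <_) wt-K∷ʳ1 j<wt))
  ... | inj₂ refl = inj₁ (subst (j ∈_) (sym AK) (∈-++⁺ʳ (A K) (here refl)))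
  ... | inj₁ j<w with covers d j 1≤j j<w
  ...   | inj₁ j∈AK = inj₁ (subst (j ∈_) (sym AK) (∈-++⁺ˡ j∈AK))
  ...   | inj₂ j∈AL = inj₂ (subst (j ∈_) (sym AL) j∈AL)
  widen : ∀ {j} → j < w → j < wt (K ∷ʳ 1)
  widen {j} j<w = subst (j <_) (sym wt-K∷ʳ1) (ℕP.m<n⇒m<1+n j<w)
  inRange′ : ∀ j → j ∈ A (K ∷ʳ 1) ⊎ j ∈ A (L ∷ʳ suc b) → 1 ≤ j × j < wt (K ∷ʳ 1)
  inRange′ j (inj₂ j∈AL) = map₂ widen (inRange d j (inj₂ (subst (j ∈_) AL j∈AL)))
  inRange′ j (inj₁ j∈AK) with ∈-++⁻ (A K) (subst (j ∈_) AK j∈AK)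
  ... | inj₁ j∈AK′ = map₂ widen (inRange d j (inj₁ j∈AK′))
  ... | inj₂ (here refl) =
          subst (1 ≤_) (weight d) (wt-positive (index d) (∷ʳ≢[] L b)) , subst (w <_) (sym wt-K∷ʳ1) (ℕP.n<1+n w)
  disjoint′ : ∀ j → ¬ (j ∈ A (K ∷ʳ 1) × j ∈ A (L ∷ʳ suc b))
  disjoint′ j (j∈AK , j∈AL) with ∈-++⁻ (A K) (subst (j ∈_) AK j∈AK)
  ... | inj₁ j∈AK′       = disjoint d j (j∈AK′ , subst (j ∈_) AL j∈AL)
  ... | inj₂ (here refl) = ℕP.<-irrefl refl (proj₂ (inRange d w (inj₂ (subst (w ∈_) AL j∈AL))))

HoffmanDual-increment : ∀ {K a L} → IsIndex (K ∷ʳ a) → L ≢ [] → IsHoffmanDual (K ∷ʳ a) L → IsHoffmanDual (K ∷ʳ suc a) (L ∷ʳ 1)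
HoffmanDual-increment ik L≢[] d =
  HoffmanDual-sym (AllP.∷ʳ⁺ (index d) (s≤s z≤n)) (HoffmanDual-∷ʳ-1 L≢[] (HoffmanDual-sym ik d))

reverse-IsIndex : ∀ {xs} → IsIndex xs → IsIndex (reverse xs)
reverse-IsIndex {[]}     []          = []
reverse-IsIndex {x ∷ xs} (1≤x ∷ ixs) = subst IsIndex (sym (LP.unfold-reverse x xs)) (AllP.∷ʳ⁺ (reverse-IsIndex ixs) 1≤x)

reverse-∷≢[] : ∀ {X : Set} (x : X) xs → reverse (x ∷ xs) ≢ []
reverse-∷≢[] x xs eq = ∷ʳ≢[] (reverse xs) x (trans (sym (LP.unfold-reverse x xs)) eq)

Dualʳ-IsIndex : ∀ {rk s} → Dualʳ rk s → IsIndex rk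
Dualʳ-IsIndex base          = s≤s z≤n ∷ []
Dualʳ-IsIndex (extend d)    = s≤s z≤n ∷ Dualʳ-IsIndex d
Dualʳ-IsIndex (increment d) with Dualʳ-IsIndex d
... | _ ∷ ir = s≤s z≤n ∷ ir

Dualʳ-sound : ∀ {rk s} → Dualʳ rk s → IsHoffmanDual (reverse rk) (reverse s)
Dualʳ-sound base = record
  { index    = s≤s z≤n ∷ []
  ; weight   = refl
  ; covers   = λ { j (s≤s z≤n) (s≤s ()) }
  ; inRange  = λ { j (inj₁ ()) ; j (inj₂ ()) }
  ; disjoint = λ { j (() , _) }
  }
Dualʳ-sound (extend {a} {r} {b} {s} d)
  rewrite LP.unfold-reverse 1 (a ∷ r) | LP.unfold-reverse (suc b) s =
  HoffmanDual-∷ʳ-1 (reverse-∷≢[] a r) (subst (IsHoffmanDual _) (LP.unfold-reverse b s) (Dualʳ-sound d))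
Dualʳ-sound (increment {a} {r} {b} {s} d)
  rewrite LP.unfold-reverse (suc a) r | LP.unfold-reverse 1 (b ∷ s) =
  HoffmanDual-increment (subst IsIndex (LP.unfold-reverse a r) (reverse-IsIndex (Dualʳ-IsIndex d))) (reverse-∷≢[] b s)
    (subst (λ k → IsHoffmanDual k _) (LP.unfold-reverse a r) (Dualʳ-sound d))

Dualʳ-exists : ∀ a r → IsIndex r → ∃₂ λ b s → Dualʳ (suc a ∷ r) (b ∷ s)
Dualʳ-exists zero    []          _          = 1 , [] , base
Dualʳ-exists zero    (zero ∷ r)  (() ∷ _)
Dualʳ-exists zero    (suc a ∷ r) (_ ∷ ir)   = let b , s , d = Dualʳ-exists a r ir in suc b , s , extend d
Dualʳ-exists (suc a) r           ir         = let b , s , d = Dualʳ-exists a r ir in 1 , b ∷ s , increment d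

A-head-≤ : ∀ x xs {j} → j ∈ A (x ∷ xs) → x ≤ j
A-head-≤ x (y ∷ ys) (here refl) = ℕP.≤-refl
A-head-≤ x (y ∷ ys) (there j∈) with ∈-map⁻ (x ℕ.+_) j∈
... | j′ , _ , refl = ℕP.m≤m+n x j′

A-⊆-tail : ∀ {x u v} → IsIndex u → A (x ∷ u) ⊆ A (x ∷ v) → A u ⊆ A v
A-⊆-tail {u = []} _ _ ()
A-⊆-tail {x} {u₀ ∷ us} {[]} _ ⊆ j∈Au with ⊆ (there (∈-map⁺ (x ℕ.+_) j∈Au))
... | ()
A-⊆-tail {x} {u₀ ∷ us} {v₀ ∷ vs} (1≤u₀ ∷ _) ⊆ {j} j∈Au with ⊆ (there (∈-map⁺ (x ℕ.+_) j∈Au))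
... | here x+j≡x = ⊥-elim (ℕP.<-irrefl (sym x+j≡x) (ℕP.m<m+n x (ℕP.≤-trans 1≤u₀ (A-head-≤ u₀ us j∈Au))))
... | there x+j∈ with ∈-map⁻ (x ℕ.+_) x+j∈
...   | j′ , j′∈Av , x+j≡x+j′ = subst (_∈ A (v₀ ∷ vs)) (sym (ℕP.+-cancelˡ-≡ x j j′ x+j≡x+j′)) j′∈Av

A-injective : ∀ {l l′} → IsIndex l → IsIndex l′ → wt l ≡ wt l′ → A l ⊆ A l′ → A l′ ⊆ A l → l ≡ l′
A-injective {[]}          {[]}          _  _   _ _ _ = refl
A-injective {[]}          {y ∷ ys}      _  il′ w _ _ = ⊥-elim (ℕP.<-irrefl w (wt-positive il′ λ ()))
A-injective {x ∷ xs}      {[]}          il _   w _ _ = ⊥-elim (ℕP.<-irrefl (sym w) (wt-positive il λ ()))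
A-injective {x ∷ []}      {y ∷ []}      _  _   w _ _ = cong (_∷ []) (ℕP.+-cancelʳ-≡ 0 x y w)
A-injective {x ∷ []}      {y ∷ y′ ∷ ys} _  _   _ _ ⊇ with ⊇ (here refl)
... | ()
A-injective {x ∷ x′ ∷ xs} {y ∷ []}      _  _   _ ⊆ _ with ⊆ (here refl)
... | ()
A-injective {x ∷ x′ ∷ xs} {y ∷ y′ ∷ ys} (_ ∷ il) (_ ∷ il′) w ⊆ ⊇
  with ℕP.≤-antisym (A-head-≤ x (x′ ∷ xs) (⊇ (here refl))) (A-head-≤ y (y′ ∷ ys) (⊆ (here refl)))
... | refl = cong (x ∷_) (A-injective il il′ (ℕP.+-cancelˡ-≡ x _ _ w) (A-⊆-tail il ⊆) (A-⊆-tail il′ ⊇))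

HoffmanDual-A-⊆ : ∀ {k l l′} → IsHoffmanDual k l → IsHoffmanDual k l′ → A l ⊆ A l′
HoffmanDual-A-⊆ d d′ {j} j∈Al with inRange d j (inj₂ j∈Al)
... | 1≤j , j<wt with covers d′ j 1≤j j<wt
...   | inj₁ j∈Ak  = ⊥-elim (disjoint d j (j∈Ak , j∈Al))
...   | inj₂ j∈Al′ = j∈Al′

HoffmanDual-unique : ∀ {k l l′} → IsHoffmanDual k l → IsHoffmanDual k l′ → l ≡ l′
HoffmanDual-unique d d′ =
  A-injective (index d) (index d′) (trans (weight d) (sym (weight d′))) (HoffmanDual-A-⊆ d d′) (HoffmanDual-A-⊆ d′ d)

newtonAt-kawashimaCoeff : ∀ k → IsIndex k → k ≢ [] → ∀ kv → IsHoffmanDual k kv →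
  ∀ N → newtonAt (kawashimaCoeff kv) N ≡ S⋆ k N
newtonAt-kawashimaCoeff k ik k≢[] kv k∨ N with reverse k in rev-k≡ | reverse-IsIndex ik
... | []        | _ = ⊥-elim (k≢[] (trans (sym (LP.reverse-involutive k)) (cong reverse rev-k≡)))
... | zero ∷ r  | () ∷ _
... | suc a ∷ r | _ ∷ ir with Dualʳ-exists a r ir
...   | b , s , d = begin
  newtonAt (kawashimaCoeff kv) N                ≡⟨ newtonAt≡newton (kawashimaCoeff kv) refl N ⟩
  newton (kawashimaCoeff kv) N                  ≡⟨ cong (λ l → newton (kawashimaCoeff l) N) kv≡ ⟩
  newton (kawashimaCoeff (reverse (b ∷ s))) N   ≡⟨ newton-kawashimaCoeff d N ⟩
  Srev (suc a ∷ r) N                            ∎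
  where
  k≡ : reverse (suc a ∷ r) ≡ k
  k≡ = trans (cong reverse (sym rev-k≡)) (LP.reverse-involutive k)
  kv≡ : kv ≡ reverse (b ∷ s)
  kv≡ = HoffmanDual-unique k∨ (subst (λ k → IsHoffmanDual k _) k≡ (Dualʳ-sound d))

-- Uniqueness of Newton coefficients

module _ {c ℓ} (R : CommutativeRing c ℓ) where
  private module R = CommutativeRing R
  open R using (Carrier; _≈_; 1#)

  ΣR-cong : ∀ N {f g} → (∀ n → n ≤ N → f n ≈ g n) → ΣR R N f ≈ ΣR R N g
  ΣR-cong zero    f≈g = f≈g 0 z≤n
  ΣR-cong (suc N) f≈g = R.+-cong (ΣR-cong N (λ n n≤N → f≈g n (ℕP.m≤n⇒m≤1+n n≤N))) (f≈g (suc N) ℕP.≤-refl)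

  unitriangular-injective : (β : ℕ → ℕ → Carrier) → (∀ N → β N N ≈ 1#) → ∀ {a b : ℕ → Carrier} →
    (∀ N → ΣR R N (λ n → β N n R.* a n) ≈ ΣR R N (λ n → β N n R.* b n)) → ∀ n → a n ≈ b n
  unitriangular-injective β βNN≈1 {a} {b} agree n = below n n ℕP.≤-refl
    where
    open GroupProperties R.+-group using (∙-cancelˡ)
    diagonal-* : ∀ N x → β N N R.* x ≈ x
    diagonal-* N x = R.trans (R.*-congʳ (βNN≈1 N)) (R.*-identityˡ x)
    cancel-diagonal : ∀ N {x y} → β N N R.* x ≈ β N N R.* y → x ≈ y
    cancel-diagonal N {x} {y} βx≈βy = R.trans (R.sym (diagonal-* N x)) (R.trans βx≈βy (diagonal-* N y))
    below : ∀ N n → n ≤ N → a n ≈ b n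
    below zero    .zero z≤n = cancel-diagonal 0 (agree 0)
    below (suc M) n n≤1+M with ℕP.m≤n⇒m<n∨m≡n n≤1+M
    ... | inj₁ (s≤s n≤M) = below M n n≤M
    ... | inj₂ refl = cancel-diagonal (suc M) (∙-cancelˡ _ _ _ (R.trans (R.+-cong (R.sym lower) R.refl) (agree (suc M))))
      where
      lower : ΣR R M (λ n → β (suc M) n R.* a n) ≈ ΣR R M (λ n → β (suc M) n R.* b n)
      lower = ΣR-cong M (λ n n≤M → R.*-congˡ (below M n n≤M))

module _ {c ℓ} (R : CommutativeRing c ℓ) {ι : ℚ → CommutativeRing.Carrier R}
  (homo : RingMorphisms.IsRingHomomorphism (CommutativeRing.rawRing +-*-commutativeRing) (CommutativeRing.rawRing R) ι) where
  private module R = CommutativeRing R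
  open R using (_≈_)
  open RingMorphisms.IsRingHomomorphism homo using (+-homo; *-homo; 1#-homo)

  ι-Σ₀ : ∀ N f → ι (Σ₀ N f) ≈ ΣR R N (ι ∘ f)
  ι-Σ₀ zero    f = R.reflexive (cong ι (ℚP.+-identityʳ (f 0)))
  ι-Σ₀ (suc N) f = R.trans (R.reflexive (cong ι (sym (ℚP.+-assoc (f 0) (Σ₁ N f) (f (suc N))))))
                            (R.trans (+-homo _ _) (R.+-cong (ι-Σ₀ N f) R.refl))

  newtonAt-coefficients : ∀ (a : ℕ → R.Carrier) c →
    (∀ N → ΣR R N (λ n → ι (binomℚ N n) R.* a n) ≈ ι (newtonAt c N)) → ∀ n → a n ≈ ι (c n)
  newtonAt-coefficients a c agree = unitriangular-injective R (λ N n → ι (binomℚ N n)) ι-binomℚ-diagonal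
    (λ N → R.trans (agree N) (R.trans (ι-Σ₀ N _) (ΣR-cong R N (λ n _ → *-homo (binomℚ N n) (c n)))))
    where
    ι-binomℚ-diagonal : ∀ N → ι (binomℚ N N) ≈ R.1#
    ι-binomℚ-diagonal N = R.trans (R.reflexive (cong (ι ∘ toℚ) (nCn≡1 N))) 1#-homo

proposition2p6 : ∀ {c ℓ : Level} (k : List ℕ) → IsIndex k → k ≢ [] →
    (kv : List ℕ) → IsHoffmanDual k kv →
    ((N : ℕ) → newtonAt (kawashimaCoeff kv) N ≡ S⋆ k N)
    × ((R : CommutativeRing c ℓ) (ι : ℚ → CommutativeRing.Carrier R) →
       RingMorphisms.IsRingHomomorphism (CommutativeRing.rawRing +-*-commutativeRing) (CommutativeRing.rawRing R) ι →
       (a : ℕ → CommutativeRing.Carrier R) →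
       ((N : ℕ) → CommutativeRing._≈_ R (ΣR R N (λ n → CommutativeRing._*_ R (ι (binomℚ N n)) (a n))) (ι (S⋆ k N))) →
       CommutativeRing._≈_ R (a 0) (CommutativeRing.0# R)
       × ((n : ℕ) → 1 ≤ n → CommutativeRing._≈_ R (a n) (ι (kawashimaCoeff kv n))))
proposition2p6 k ik k≢[] kv k∨ = values , λ R ι homo a agree →
  let module R = CommutativeRing R
      coefficient = newtonAt-coefficients R homo a (kawashimaCoeff kv) (λ N → R.trans (agree N) (R.reflexive (cong ι (sym (values N)))))
  in R.trans (coefficient 0) (RingMorphisms.IsRingHomomorphism.0#-homo homo) , λ n _ → coefficient n
  where
  values : ∀ N → newtonAt (kawashimaCoeff kv) N ≡ S⋆ k N
  values = newtonAt-kawashimaCoeff k ik k≢[] kv k∨
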